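{- The fractional separation dimension of the Petersen graph is $\frac{30}{17}$.
   Context: Two edges are nonincident if they share no endpoint. A linear ordering of $V(G)$ separates a pair of nonincident edges if both endpoints of one edge precede both endpoints of the other. $\pi_t(G)$ is the minimum length of a list of linear orderings of $V(G)$ (repetitions allowed) separating every pair of nonincident edges at least $t$ times, and the fractional separation dimension is $\pi_f(G)=\liminf_{t\to\infty}\pi_t(G)/t$. -}

module Defs where

open import Data.Nat using (ℕ; zero; suc; _+_; _*_; _<_; _≤_; _⊔_; _⊓_)
open import Data.Nat.Properties using (_<?_)
open import Data.Fin using (Fin; toℕ) renaming (zero to f0; suc to fs)
open import Data.Fin.Permutation using (Permutation′; _⟨$⟩ʳ_)
open import Data.List using (List; length; filter)
open import Data.Product using (_×_; _,_; ∃; ∃-syntax; Σ-syntax)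
open import Data.Sum using (_⊎_)
open import Relation.Nullary using (¬_; Dec)
open import Relation.Nullary.Decidable using (_⊎-dec_)
open import Relation.Binary.PropositionalEquality using (_≡_)

record Graph : Set₁ where
  field
    n   : ℕ
    Adj : Fin n → Fin n → Set

open Graph public

Ordering : ℕ → Set
Ordering n = Permutation′ n

pos : {n : ℕ} → Ordering n → Fin n → ℕ
pos σ v = toℕ (σ ⟨$⟩ʳ v)

Precedes : {n : ℕ} → Ordering n → Fin n → Fin n → Fin n → Fin n → Set
Precedes σ u v x y = (pos σ u ⊔ pos σ v) < (pos σ x ⊓ pos σ y)

Separates : {n : ℕ} → Ordering n → Fin n → Fin n → Fin n → Fin n → Set
Separates σ u v x y = Precedes σ u v x y ⊎ Precedes σ x y u v

separates? : {n : ℕ} (u v x y : Fin n) (σ : Ordering n) → Dec (Separates σ u v x y)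
separates? u v x y σ =
  ((pos σ u ⊔ pos σ v) <? (pos σ x ⊓ pos σ y)) ⊎-dec ((pos σ x ⊔ pos σ y) <? (pos σ u ⊓ pos σ v))

sepCount : {n : ℕ} → List (Ordering n) → Fin n → Fin n → Fin n → Fin n → ℕ
sepCount L u v x y = length (filter (separates? u v x y) L)

Nonincident : {n : ℕ} → Fin n → Fin n → Fin n → Fin n → Set
Nonincident u v x y = ¬ u ≡ x × ¬ u ≡ y × ¬ v ≡ x × ¬ v ≡ y

TSeparating : (G : Graph) → ℕ → List (Ordering (n G)) → Set
TSeparating G t L =
  ∀ u v x y → Adj G u v → Adj G x y → Nonincident u v x y → t ≤ sepCount L u v x y

πLe : Graph → ℕ → ℕ → Set
πLe G t m = Σ[ L ∈ List (Ordering (n G)) ] (length L ≡ m × TSeparating G t L)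

πEq : Graph → ℕ → ℕ → Set
πEq G t m = πLe G t m × (∀ m′ → πLe G t m′ → m ≤ m′)

-- π_f(G) = liminf_{t→∞} π_t(G)/t equals p/q  (q ≥ 1), written with ε = 1/k and
-- all divisions cleared (everything in ℕ):
--  (i)  for every k ≥ 1, eventually π_t(G)/t ≥ p/q - 1/k, i.e.  p·k·t ≤ q·k·π_t + q·t;
--  (ii) for every k ≥ 1, infinitely often π_t(G)/t ≤ p/q + 1/k, i.e. q·k·π_t ≤ p·k·t + q·t.
FracSepDimEq : Graph → ℕ → ℕ → Set
FracSepDimEq G p q =
  (∀ k → 1 ≤ k → ∃[ T ] ∀ t → T ≤ t → 1 ≤ t → ∀ m → πEq G t m →
       p * k * t ≤ q * k * m + q * t)
  × (∀ k → 1 ≤ k → ∀ T → ∃[ t ] (T ≤ t × 1 ≤ t × ∃[ m ] (πEq G t m ×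
       q * k * m ≤ p * k * t + q * t)))

-- Petersen graph = Kneser graph K(5,2): vertices are the 2-subsets of {0,…,4},
-- adjacent iff disjoint.
label : Fin 10 → Fin 5 × Fin 5
label v = lab (toℕ v)
  where
  open import Data.Fin using (#_)
  lab : ℕ → Fin 5 × Fin 5
  lab 0 = (# 0 , # 1)
  lab 1 = (# 0 , # 2)
  lab 2 = (# 0 , # 3)
  lab 3 = (# 0 , # 4)
  lab 4 = (# 1 , # 2)
  lab 5 = (# 1 , # 3)
  lab 6 = (# 1 , # 4)
  lab 7 = (# 2 , # 3)
  lab 8 = (# 2 , # 4)
  lab _ = (# 3 , # 4)

PetersenAdj : Fin 10 → Fin 10 → Set
PetersenAdj u v with label u | label v
... | (a , b) | (c , d) = ¬ a ≡ c × ¬ a ≡ d × ¬ b ≡ c × ¬ b ≡ d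

Petersen : Graph
Petersen = record { n = 10 ; Adj = PetersenAdj }

-- The 60 pairs of disjoint edges of the Petersen graph that are joined by an
-- edge form one orbit of its automorphism group S₅.  When an ordering
-- separates such a pair, the pair is counted at the step where the later
-- endpoint of its earlier edge enters the prefix while the other edge is still
-- outside; maximising these counts over chains of prefix sets (a dynamic
-- programme over the subsets of the vertex set) shows that no ordering
-- separates more than 34 of the 60 pairs, so double counting gives
-- 60 t ≤ 34 π_t.  Conversely, the 120 images under S₅ of one ordering that
-- separates 34 of these pairs and 9 of the 15 remaining pairs of disjoint edges
-- separate each pair of the first orbit 2·34 = 68 times and each of the second
-- 8·9 = 72 times, so π_{68c} ≤ 120c.  Both bounds have ratio 30/17.

module Submission where

open import Defs
open import Data.Nat using (ℕ; zero; suc; _+_; _*_; _≤_; _<_; _⊔_; z≤n; s≤s; NonZero)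
open import Data.Nat.Properties
open import Data.Nat.Tactic.RingSolver using (solve-∀)
open import Data.Bool using (Bool; true; false; _∧_; not; if_then_else_)
open import Data.Bool.Properties using (∧-zeroʳ)
open import Data.Fin as Fin using (Fin; toℕ; fromℕ<; #_)
open import Data.Fin.Properties using (toℕ-fromℕ<; toℕ-injective; toℕ<n; all?; any?)
  renaming (_≟_ to _≟ᶠ_; _<?_ to _<ᶠ?_)
open import Data.Fin.Permutation using (_⟨$⟩ʳ_; _⟨$⟩ˡ_; permutation; inverseˡ; inverseʳ)
open import Data.Fin.Subset using (Subset; ⊤)
open import Data.Vec as Vec using (Vec; []; _∷_; lookup; tabulate; _[_]≔_)
open import Data.Vec.Properties
  using (lookup∘tabulate; tabulate∘lookup; tabulate-cong; lookup∘update; lookup∘update′; lookup-replicate)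
open import Data.List as List
  using (List; []; _∷_; _++_; length; filter; map; concatMap; mapMaybe; cartesianProductWith)
open import Data.List.Properties using (length-++; filter-++)
open import Data.List.Relation.Unary.All as All using (All)
open import Data.Maybe using (Maybe; just; nothing)
open import Data.Product using (_×_; _,_; ∃-syntax)
open import Data.Product.Properties using (≡-dec)
open import Data.Sum using (_⊎_; inj₁; inj₂)
open import Function using (_∘_)
open import Relation.Nullary using (Dec; yes; no; does; ¬?)
open import Relation.Nullary.Decidable using (_×-dec_; _⊎-dec_; _→-dec_; dec-true; dec-false; from-yes)
open import Relation.Binary.PropositionalEquality
  using (_≡_; refl; sym; trans; cong; cong₂; module ≡-Reasoning)
open import Algebra.Properties.CommutativeSemigroup +-commutativeSemigroup using (interchange)

private
  variable
    N : ℕ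

∑ : {A : Set} → List A → (A → ℕ) → ℕ
∑ []       f = 0
∑ (x ∷ xs) f = f x + ∑ xs f

∑-cong : {A : Set} (xs : List A) {f g : A → ℕ} → (∀ x → f x ≡ g x) → ∑ xs f ≡ ∑ xs g
∑-cong []       f≡g = refl
∑-cong (x ∷ xs) f≡g = cong₂ _+_ (f≡g x) (∑-cong xs f≡g)

∑-const : {A : Set} (xs : List A) (c : ℕ) → ∑ xs (λ _ → c) ≡ length xs * c
∑-const []       c = refl
∑-const (x ∷ xs) c = cong (c +_) (∑-const xs c)

∑-+ : {A : Set} (xs : List A) (f g : A → ℕ) → ∑ xs (λ x → f x + g x) ≡ ∑ xs f + ∑ xs g
∑-+ []       f g = refl
∑-+ (x ∷ xs) f g = trans (cong (f x + g x +_) (∑-+ xs f g)) (interchange (f x) (g x) _ _)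

∑-monoᴬ : {A : Set} {xs : List A} {f g : A → ℕ} → All (λ x → f x ≤ g x) xs → ∑ xs f ≤ ∑ xs g
∑-monoᴬ All.[]         = z≤n
∑-monoᴬ (fx≤gx All.∷ h) = +-mono-≤ fx≤gx (∑-monoᴬ h)

∑< : ℕ → (ℕ → ℕ) → ℕ
∑< zero    f = 0
∑< (suc k) f = ∑< k f + f k

∑<-≥ : ∀ {k r} (f : ℕ → ℕ) → r < k → f r ≤ ∑< k f
∑<-≥ {suc k} {r} f r<1+k with m<1+n⇒m<n∨m≡n r<1+k
... | inj₁ r<k  = ≤-trans (∑<-≥ f r<k) (m≤m+n _ _)
... | inj₂ refl = m≤n+m _ _

∑-∑<-comm : {A : Set} (xs : List A) (k : ℕ) (f : ℕ → A → ℕ) →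
            ∑ xs (λ x → ∑< k (λ r → f r x)) ≡ ∑< k (λ r → ∑ xs (f r))
∑-∑<-comm xs zero    f = trans (∑-const xs 0) (*-zeroʳ (length xs))
∑-∑<-comm xs (suc k) f =
  trans (∑-+ xs _ (f k)) (cong (_+ ∑ xs (f k)) (∑-∑<-comm xs k f))

𝟙 : Bool → ℕ
𝟙 true  = 1
𝟙 false = 0

record EdgePair (n : ℕ) : Set where
  constructor _─_∣_─_
  field a b c d : Fin n

swapEdges : EdgePair N → EdgePair N
swapEdges (a ─ b ∣ c ─ d) = c ─ d ∣ a ─ b

NonincidentEdges : (G : Graph) → EdgePair (n G) → Set
NonincidentEdges G (a ─ b ∣ c ─ d) = Adj G a b × Adj G c d × Nonincident a b c d

isSeparated : Ordering N → EdgePair N → ℕ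
isSeparated σ (a ─ b ∣ c ─ d) = 𝟙 (does (separates? a b c d σ))

separatedIn : Ordering N → List (EdgePair N) → ℕ
separatedIn σ P = ∑ P (isSeparated σ)

timesSeparated : List (Ordering N) → EdgePair N → ℕ
timesSeparated L (a ─ b ∣ c ─ d) = sepCount L a b c d

timesSeparated-∷ : (σ : Ordering N) (L : List (Ordering N)) (p : EdgePair N) →
                   timesSeparated (σ ∷ L) p ≡ isSeparated σ p + timesSeparated L p
timesSeparated-∷ σ L (a ─ b ∣ c ─ d) with does (separates? a b c d σ)
... | true  = refl
... | false = refl

∑-timesSeparated : (P : List (EdgePair N)) (L : List (Ordering N)) →
                   ∑ P (timesSeparated L) ≡ ∑ L (λ σ → separatedIn σ P)
∑-timesSeparated P []      = trans (∑-cong P λ { (_ ─ _ ∣ _ ─ _) → refl })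
                                   (trans (∑-const P 0) (*-zeroʳ (length P)))
∑-timesSeparated P (σ ∷ L) =
  trans (∑-cong P (timesSeparated-∷ σ L))
        (trans (∑-+ P (isSeparated σ) (timesSeparated L))
               (cong (separatedIn σ P +_) (∑-timesSeparated P L)))

separation-lowerBound : ∀ {G t b} (P : List (EdgePair (n G))) → All (NonincidentEdges G) P →
                        (∀ σ → separatedIn σ P ≤ b) →
                        ∀ {L} → TSeparating G t L → length P * t ≤ length L * b
separation-lowerBound {G} {t} {b} P valid bound {L} separating = begin
  length P * t                   ≡⟨ ∑-const P t ⟨
  ∑ P (λ _ → t)                  ≤⟨ ∑-monoᴬ (All.map often valid) ⟩
  ∑ P (timesSeparated L)         ≡⟨ ∑-timesSeparated P L ⟩
  ∑ L (λ σ → separatedIn σ P)    ≤⟨ ∑-monoᴬ (All.universal bound L) ⟩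
  ∑ L (λ _ → b)                  ≡⟨ ∑-const L b ⟩
  length L * b                   ∎
  where
  open ≤-Reasoning
  often : ∀ {p} → NonincidentEdges G p → t ≤ timesSeparated L p
  often {a ─ b ∣ c ─ d} (ab , cd , disjoint) = separating a b c d ab cd disjoint

sepCount-++ : (L L′ : List (Ordering N)) (u v x y : Fin N) →
              sepCount (L ++ L′) u v x y ≡ sepCount L u v x y + sepCount L′ u v x y
sepCount-++ L L′ u v x y =
  trans (cong length (filter-++ (separates? u v x y) L L′)) (length-++ (filter (separates? u v x y) L))

TSeparating-++ : ∀ {G s t L L′} → TSeparating G s L → TSeparating G t L′ →
                 TSeparating G (s + t) (L ++ L′)
TSeparating-++ {L = L} {L′} sepL sepL′ u v x y uv xy disjoint =
  ≤-trans (+-mono-≤ (sepL u v x y uv xy disjoint) (sepL′ u v x y uv xy disjoint))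
          (≤-reflexive (sym (sepCount-++ L L′ u v x y)))

πLe-+ : ∀ {G s t m m′} → πLe G s m → πLe G t m′ → πLe G (s + t) (m + m′)
πLe-+ (L , refl , sepL) (L′ , refl , sepL′) =
  L ++ L′ , length-++ L , TSeparating-++ {L = L} {L′} sepL sepL′

πLe-* : ∀ {G t m} → πLe G t m → ∀ c → πLe G (c * t) (c * m)
πLe-* le zero    = [] , refl , λ _ _ _ _ _ _ _ → z≤n
πLe-* le (suc c) = πLe-+ le (πLe-* le c)

fracSepDim-fromBounds : ∀ {G} p q {T M} .{{_ : NonZero q}} .{{_ : NonZero T}} →
                        q * M ≡ p * T → πLe G T M → (∀ {t m} → πLe G t m → p * t ≤ q * m) →
                        FracSepDimEq G p q
fracSepDim-fromBounds {G} p q {T} {M} qM≡pT upper lower = eventuallyAbove , infinitelyOftenBelow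
  where
  open ≤-Reasoning

  reassoc : ∀ a b c → a * b * c ≡ b * (a * c)
  reassoc = solve-∀

  eventuallyAbove : ∀ k → 1 ≤ k → ∃[ T₀ ] ∀ t → T₀ ≤ t → 1 ≤ t → ∀ m → πEq G t m →
                    p * k * t ≤ q * k * m + q * t
  eventuallyAbove k _ = 0 , λ t _ _ m (le , _) → begin
    p * k * t          ≡⟨ reassoc p k t ⟩
    k * (p * t)        ≤⟨ *-monoʳ-≤ k (lower le) ⟩
    k * (q * m)        ≡⟨ reassoc q k m ⟨
    q * k * m          ≤⟨ m≤m+n _ _ ⟩
    q * k * m + q * t  ∎

  infinitelyOftenBelow : ∀ k → 1 ≤ k → ∀ T₀ →
                         ∃[ t ] (T₀ ≤ t × 1 ≤ t × ∃[ m ] (πEq G t m × q * k * m ≤ p * k * t + q * t))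
  infinitelyOftenBelow k _ T₀ =
    c * T , <⇒≤ T₀<t , ≤-trans (s≤s z≤n) T₀<t , c * M , (πLe-* upper c , minimal) , below
    where
    c = suc T₀
    T₀<t : T₀ < c * T
    T₀<t = m≤m*n c T
    scaled : q * (c * M) ≡ p * (c * T)
    scaled = begin-equality
      q * (c * M)  ≡⟨ trans (sym (*-assoc q c M)) (reassoc q c M) ⟩
      c * (q * M)  ≡⟨ cong (c *_) qM≡pT ⟩
      c * (p * T)  ≡⟨ trans (sym (*-assoc p c T)) (reassoc p c T) ⟨
      p * (c * T)  ∎
    minimal : ∀ m′ → πLe G (c * T) m′ → c * M ≤ m′
    minimal m′ le = *-cancelˡ-≤ q (≤-trans (≤-reflexive scaled) (lower le))
    below : q * k * (c * M) ≤ p * k * (c * T) + q * (c * T)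
    below = begin
      q * k * (c * M)    ≡⟨ reassoc q k (c * M) ⟩
      k * (q * (c * M))  ≡⟨ cong (k *_) scaled ⟩
      k * (p * (c * T))  ≡⟨ reassoc p k (c * T) ⟨
      p * k * (c * T)    ≤⟨ m≤m+n _ _ ⟩
      p * k * (c * T) + q * (c * T) ∎

≡-fromLookups : ∀ {A : Set} {xs ys : Vec A N} → (∀ i → lookup xs i ≡ lookup ys i) → xs ≡ ys
≡-fromLookups {xs = xs} {ys} same =
  trans (sym (tabulate∘lookup xs)) (trans (tabulate-cong same) (tabulate∘lookup ys))

pos-injective : (σ : Ordering N) {u v : Fin N} → pos σ u ≡ pos σ v → u ≡ v
pos-injective σ {u} {v} same = begin
  u                    ≡⟨ inverseˡ σ ⟨
  σ ⟨$⟩ˡ (σ ⟨$⟩ʳ u)  ≡⟨ cong (σ ⟨$⟩ˡ_) (toℕ-injective same) ⟩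
  σ ⟨$⟩ˡ (σ ⟨$⟩ʳ v)  ≡⟨ inverseˡ σ ⟩
  v                    ∎
  where open ≡-Reasoning

prefix : Ordering N → ℕ → Subset N
prefix σ r = tabulate λ u → does (pos σ u <? r)

prefix-∋ : (σ : Ordering N) {r : ℕ} {u : Fin N} → pos σ u < r → lookup (prefix σ r) u ≡ true
prefix-∋ σ {r} {u} u<r = trans (lookup∘tabulate _ u) (dec-true (pos σ u <? r) u<r)

prefix-∌ : (σ : Ordering N) {r : ℕ} {u : Fin N} → r ≤ pos σ u → lookup (prefix σ r) u ≡ false
prefix-∌ σ {r} {u} r≤u = trans (lookup∘tabulate _ u) (dec-false (pos σ u <? r) (≤⇒≯ r≤u))

prefix-all : (σ : Ordering N) → prefix σ N ≡ ⊤
prefix-all σ = ≡-fromLookups λ u → trans (prefix-∋ σ (toℕ<n _)) (sym (lookup-replicate u true))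

vertexAt : Ordering N → {r : ℕ} → r < N → Fin N
vertexAt σ r<N = σ ⟨$⟩ˡ fromℕ< r<N

pos-vertexAt : (σ : Ordering N) {r : ℕ} (r<N : r < N) → pos σ (vertexAt σ r<N) ≡ r
pos-vertexAt σ r<N = trans (cong toℕ (inverseʳ σ)) (toℕ-fromℕ< r<N)

prefix-removeLast : (σ : Ordering N) {r : ℕ} (r<N : r < N) →
                    prefix σ (suc r) [ vertexAt σ r<N ]≔ false ≡ prefix σ r
prefix-removeLast σ {r} r<N = ≡-fromLookups pointwise
  where
  B = prefix σ (suc r)
  v = vertexAt σ r<N
  pointwise : ∀ u → lookup (B [ v ]≔ false) u ≡ lookup (prefix σ r) u
  pointwise u with u ≟ᶠ v
  ... | yes refl =
    trans (lookup∘update v B false) (sym (prefix-∌ σ (≤-reflexive (sym (pos-vertexAt σ r<N)))))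
  ... | no u≢v with pos σ u <? r
  ...   | yes u<r =
    trans (lookup∘update′ u≢v B false) (trans (prefix-∋ σ (m<n⇒m<1+n u<r)) (sym (prefix-∋ σ u<r)))
  ...   | no u≮r  =
    trans (lookup∘update′ u≢v B false) (trans (prefix-∌ σ r<u) (sym (prefix-∌ σ (<⇒≤ r<u))))
    where
    r<u : r < pos σ u
    r<u = ≤∧≢⇒< (≮⇒≥ u≮r) λ r≡u →
      u≢v (pos-injective σ (trans (sym r≡u) (sym (pos-vertexAt σ r<N))))

completes : Subset N → Subset N → EdgePair N → Bool
completes A B (a ─ b ∣ c ─ d) =
  lookup B a ∧ lookup B b ∧ not (lookup B c) ∧ not (lookup B d) ∧ not (lookup A a ∧ lookup A b)

newlySeparated : Subset N → Subset N → EdgePair N → ℕ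
newlySeparated A B p = 𝟙 (completes A B p) + 𝟙 (completes A B (swapEdges p))

gain : List (EdgePair N) → Subset N → Subset N → ℕ
gain P A B = ∑ P (newlySeparated A B)

precedes⇒completes : (σ : Ordering N) {a b c d : Fin N} → Precedes σ a b c d →
                     let r = pos σ a ⊔ pos σ b in
                     completes (prefix σ r) (prefix σ (suc r)) (a ─ b ∣ c ─ d) ≡ true
precedes⇒completes σ {a} {b} {c} {d} ab<cd
  rewrite prefix-∋ σ {u = a} (s≤s (m≤m⊔n (pos σ a) (pos σ b)))
        | prefix-∋ σ {u = b} (s≤s (m≤n⊔m (pos σ a) (pos σ b)))
        | prefix-∌ σ {u = c} (≤-trans ab<cd (m⊓n≤m (pos σ c) (pos σ d)))
        | prefix-∌ σ {u = d} (≤-trans ab<cd (m⊓n≤n (pos σ c) (pos σ d)))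
  = lastNotBoth (⊔-sel (pos σ a) (pos σ b))
  where
  A = prefix σ (pos σ a ⊔ pos σ b)
  lastNotBoth : (pos σ a ⊔ pos σ b ≡ pos σ a) ⊎ (pos σ a ⊔ pos σ b ≡ pos σ b) →
                not (lookup A a ∧ lookup A b) ≡ true
  lastNotBoth (inj₁ r≡a) rewrite prefix-∌ σ {u = a} (≤-reflexive r≡a) = refl
  lastNotBoth (inj₂ r≡b) rewrite prefix-∌ σ {u = b} (≤-reflexive r≡b) = cong not (∧-zeroʳ _)

1≤𝟙 : {b : Bool} → b ≡ true → 1 ≤ 𝟙 b
1≤𝟙 refl = ≤-refl

precedes⇒last<N : (σ : Ordering N) {a b c d : Fin N} → Precedes σ a b c d → pos σ a ⊔ pos σ b < N
precedes⇒last<N σ {c = c} {d} ab<cd =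
  <-≤-trans ab<cd (≤-trans (m⊓n≤m (pos σ c) (pos σ d)) (<⇒≤ (toℕ<n (σ ⟨$⟩ʳ c))))

isSeparated≤sweep : (σ : Ordering N) (p : EdgePair N) →
                    isSeparated σ p ≤ ∑< N (λ r → newlySeparated (prefix σ r) (prefix σ (suc r)) p)
isSeparated≤sweep {N} σ p@(a ─ b ∣ c ─ d) = counted (separates? a b c d σ)
  where
  newly : ℕ → ℕ
  newly r = newlySeparated (prefix σ r) (prefix σ (suc r)) p
  counted : (s? : Dec (Separates {N} σ a b c d)) → 𝟙 (does s?) ≤ ∑< N newly
  counted (no _)             = z≤n
  counted (yes (inj₁ ab<cd)) =
    ≤-trans (≤-trans (1≤𝟙 (precedes⇒completes σ ab<cd)) (m≤m+n _ _))
            (∑<-≥ newly (precedes⇒last<N σ ab<cd))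
  counted (yes (inj₂ cd<ab)) =
    ≤-trans (≤-trans (1≤𝟙 (precedes⇒completes σ cd<ab)) (m≤n+m _ _))
            (∑<-≥ newly (precedes⇒last<N σ cd<ab))

sweep : List (EdgePair N) → Ordering N → ℕ → ℕ
sweep P σ k = ∑< k λ r → gain P (prefix σ r) (prefix σ (suc r))

separatedIn≤sweep : (P : List (EdgePair N)) (σ : Ordering N) → separatedIn σ P ≤ sweep P σ N
separatedIn≤sweep {N} P σ =
  ≤-trans (∑-monoᴬ (All.universal (isSeparated≤sweep σ) P))
          (≤-reflexive (∑-∑<-comm P N λ r → newlySeparated (prefix σ r) (prefix σ (suc r))))

data Trie (A : Set) : ℕ → Set where
  leaf : A → Trie A zero
  node : Trie A N → Trie A N → Trie A (suc N)

lookupᵀ : {A : Set} → Trie A N → Subset N → A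
lookupᵀ (leaf x)   []          = x
lookupᵀ (node l r) (false ∷ s) = lookupᵀ l s
lookupᵀ (node l r) (true  ∷ s) = lookupᵀ r s

tabulateᵀ : {A : Set} → (Subset N → A) → Trie A N
tabulateᵀ {zero}  f = leaf (f [])
tabulateᵀ {suc N} f = node (tabulateᵀ (f ∘ (false ∷_))) (tabulateᵀ (f ∘ (true ∷_)))

lookupᵀ∘tabulateᵀ : {A : Set} (f : Subset N → A) (s : Subset N) → lookupᵀ (tabulateᵀ f) s ≡ f s
lookupᵀ∘tabulateᵀ f []          = refl
lookupᵀ∘tabulateᵀ f (false ∷ s) = lookupᵀ∘tabulateᵀ (f ∘ (false ∷_)) s
lookupᵀ∘tabulateᵀ f (true  ∷ s) = lookupᵀ∘tabulateᵀ (f ∘ (true ∷_)) s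

maxOver : (Fin N → ℕ) → ℕ
maxOver {zero}  f = 0
maxOver {suc N} f = f Fin.zero ⊔ maxOver (f ∘ Fin.suc)

≤-maxOver : (f : Fin N → ℕ) (i : Fin N) → f i ≤ maxOver f
≤-maxOver f Fin.zero    = m≤m⊔n _ _
≤-maxOver f (Fin.suc i) = ≤-trans (≤-maxOver (f ∘ Fin.suc) i) (m≤n⊔m _ _)

endingWith : List (EdgePair N) → Trie ℕ N → Subset N → Fin N → ℕ
endingWith P T B v = lookupᵀ T (B [ v ]≔ false) + gain P (B [ v ]≔ false) B

-- The previous level is passed to extend as an argument, so that evaluation
-- (which is call-by-need) tabulates each level once.
bestSweep : List (EdgePair N) → ℕ → Trie ℕ N
bestSweep P zero    = tabulateᵀ λ _ → 0
bestSweep P (suc k) = extend (bestSweep P k)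
  where
  extend : Trie ℕ _ → Trie ℕ _
  extend T = tabulateᵀ λ B → maxOver λ v → if lookup B v then endingWith P T B v else 0

bestSweep-≥ : (P : List (EdgePair N)) (k : ℕ) {B : Subset N} {v : Fin N} → lookup B v ≡ true →
              endingWith P (bestSweep P k) B v ≤ lookupᵀ (bestSweep P (suc k)) B
bestSweep-≥ P k {B} {v} v∈B = begin
  endingWith P T B v               ≡⟨ cong (λ b → if b then endingWith P T B v else 0) v∈B ⟨
  candidate v                      ≤⟨ ≤-maxOver candidate v ⟩
  maxOver candidate                ≡⟨ lookupᵀ∘tabulateᵀ _ B ⟨
  lookupᵀ (bestSweep P (suc k)) B  ∎
  where
  open ≤-Reasoning
  T = bestSweep P k
  candidate : Fin _ → ℕ
  candidate w = if lookup B w then endingWith P T B w else 0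

sweep≤bestSweep : (P : List (EdgePair N)) (σ : Ordering N) {k : ℕ} → k ≤ N →
                  sweep P σ k ≤ lookupᵀ (bestSweep P k) (prefix σ k)
sweep≤bestSweep P σ {zero}  _   = z≤n
sweep≤bestSweep P σ {suc k} k<N = begin
  sweep P σ k + gain P (prefix σ k) (prefix σ (suc k))
    ≤⟨ +-monoˡ-≤ _ (sweep≤bestSweep P σ (<⇒≤ k<N)) ⟩
  lookupᵀ (bestSweep P k) (prefix σ k) + gain P (prefix σ k) (prefix σ (suc k))
    ≡⟨ cong (λ A → lookupᵀ (bestSweep P k) A + gain P A B) (prefix-removeLast σ k<N) ⟨
  endingWith P (bestSweep P k) B v
    ≤⟨ bestSweep-≥ P k (prefix-∋ σ (s≤s (≤-reflexive (pos-vertexAt σ k<N)))) ⟩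
  lookupᵀ (bestSweep P (suc k)) (prefix σ (suc k)) ∎
  where
  open ≤-Reasoning
  B = prefix σ (suc k)
  v = vertexAt σ k<N

separatedIn≤bestSweep : (P : List (EdgePair N)) (σ : Ordering N) →
                        separatedIn σ P ≤ lookupᵀ (bestSweep P N) ⊤
separatedIn≤bestSweep {N} P σ = begin
  separatedIn σ P                         ≤⟨ separatedIn≤sweep P σ ⟩
  sweep P σ N                             ≤⟨ sweep≤bestSweep P σ ≤-refl ⟩
  lookupᵀ (bestSweep P N) (prefix σ N)    ≡⟨ cong (lookupᵀ (bestSweep P N)) (prefix-all σ) ⟩
  lookupᵀ (bestSweep P N) ⊤               ∎
  where open ≤-Reasoning

nonincident? : (u v x y : Fin N) → Dec (Nonincident u v x y)
nonincident? u v x y = ¬? (u ≟ᶠ x) ×-dec ¬? (u ≟ᶠ y) ×-dec ¬? (v ≟ᶠ x) ×-dec ¬? (v ≟ᶠ y)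

module _ (G : Graph) (adj? : ∀ u v → Dec (Adj G u v)) where

  tSeparating? : ∀ t L → Dec (TSeparating G t L)
  tSeparating? t L = all? λ u → all? λ v → all? λ x → all? λ y →
    adj? u v →-dec adj? x y →-dec nonincident? u v x y →-dec t ≤? sepCount L u v x y

  nonincidentEdges? : ∀ p → Dec (NonincidentEdges G p)
  nonincidentEdges? (a ─ b ∣ c ─ d) = adj? a b ×-dec adj? c d ×-dec nonincident? a b c d

insertions : {A : Set} → A → Vec A N → List (Vec A (suc N))
insertions x []       = (x ∷ []) ∷ []
insertions x (y ∷ ys) = (x ∷ y ∷ ys) ∷ map (y ∷_) (insertions x ys)

arrangements : {A : Set} → Vec A N → List (Vec A N)
arrangements []       = [] ∷ []
arrangements (x ∷ xs) = concatMap (insertions x) (arrangements xs)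

positionIn : Vec (Fin N) N → Fin N → Fin N
positionIn s v with any? (λ i → lookup s i ≟ᶠ v)
... | yes (i , _) = i
... | no _        = v

fromInverses : (order positions : Vec (Fin N) N) → Maybe (Ordering N)
fromInverses s p with all? (λ i → lookup p (lookup s i) ≟ᶠ i)
                  | all? (λ v → lookup s (lookup p v) ≟ᶠ v)
... | yes p∘s≡id | yes s∘p≡id = just (permutation (lookup p) (lookup s) p∘s≡id s∘p≡id)
... | _          | _          = nothing

fromSequence : Vec (Fin N) N → Maybe (Ordering N)
fromSequence s = fromInverses s (tabulate (positionIn s))

adjacent? : ∀ u v → Dec (PetersenAdj u v)
adjacent? u v with label u | label v
... | (a , b) | (c , d) = ¬? (a ≟ᶠ c) ×-dec ¬? (a ≟ᶠ d) ×-dec ¬? (b ≟ᶠ c) ×-dec ¬? (b ≟ᶠ d)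

edges : List (Fin 10 × Fin 10)
edges = filter (λ (u , v) → u <ᶠ? v ×-dec adjacent? u v)
               (List.cartesianProduct (List.allFin 10) (List.allFin 10))

-- a < c keeps one of the two orders of each pair.
distanceOnePairs : List (EdgePair 10)
distanceOnePairs = filter (λ (a ─ b ∣ c ─ d) → a <ᶠ? c ×-dec nonincident? a b c d ×-dec joined a b c d)
                          (cartesianProductWith (λ (a , b) (c , d) → a ─ b ∣ c ─ d) edges edges)
  where
  joined : (a b c d : Fin 10) →
           Dec (PetersenAdj a c ⊎ PetersenAdj a d ⊎ PetersenAdj b c ⊎ PetersenAdj b d)
  joined a b c d = adjacent? a c ⊎-dec adjacent? a d ⊎-dec adjacent? b c ⊎-dec adjacent? b d

distanceOnePairs-length : length distanceOnePairs ≡ 60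
distanceOnePairs-length = refl

distanceOnePairs-nonincident : All (NonincidentEdges Petersen) distanceOnePairs
distanceOnePairs-nonincident = from-yes (All.all? (nonincidentEdges? Petersen adjacent?) distanceOnePairs)

bestSweep-distanceOnePairs : lookupᵀ (bestSweep distanceOnePairs 10) ⊤ ≡ 34
bestSweep-distanceOnePairs = refl

_≟ˡ_ : (p q : Fin 5 × Fin 5) → Dec (p ≡ q)
_≟ˡ_ = ≡-dec _≟ᶠ_ _≟ᶠ_

vertexWithLabel : Fin 5 → Fin 5 → Fin 10
vertexWithLabel x y with any? (λ w → label w ≟ˡ (x , y) ⊎-dec label w ≟ˡ (y , x))
... | yes (w , _) = w
... | no _        = # 0

relabel : (Fin 5 → Fin 5) → Fin 10 → Fin 10
relabel π v with label v
... | (a , b) = vertexWithLabel (π a) (π b)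

-- Found by computer search.
baseOrdering : Vec (Fin 10) 10
baseOrdering = # 1 ∷ # 6 ∷ # 2 ∷ # 5 ∷ # 8 ∷ # 0 ∷ # 7 ∷ # 3 ∷ # 4 ∷ # 9 ∷ []

symmetrizedOrderings : List (Ordering 10)
symmetrizedOrderings =
  mapMaybe (λ π → fromSequence (Vec.map (relabel (lookup π)) baseOrdering)) (arrangements (Vec.allFin 5))

symmetrizedOrderings-length : length symmetrizedOrderings ≡ 120
symmetrizedOrderings-length = refl

symmetrizedOrderings-separating : TSeparating Petersen 68 symmetrizedOrderings
symmetrizedOrderings-separating = from-yes (tSeparating? Petersen adjacent? 68 symmetrizedOrderings)

petersen-upperBound : πLe Petersen 68 120
petersen-upperBound = symmetrizedOrderings , symmetrizedOrderings-length , symmetrizedOrderings-separating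

petersen-lowerBound : ∀ {t m} → πLe Petersen t m → 30 * t ≤ 17 * m
petersen-lowerBound {t} (L , refl , separating) = *-cancelˡ-≤ 2 (begin
  2 * (30 * t)                ≡⟨ *-assoc 2 30 t ⟨
  60 * t                      ≡⟨ cong (_* t) distanceOnePairs-length ⟨
  length distanceOnePairs * t
    ≤⟨ separation-lowerBound distanceOnePairs distanceOnePairs-nonincident atMost34 {L} separating ⟩
  length L * 34               ≡⟨ trans (*-comm (length L) 34) (*-assoc 2 17 (length L)) ⟩
  2 * (17 * length L)         ∎)
  where
  open ≤-Reasoning
  atMost34 : ∀ σ → separatedIn σ distanceOnePairs ≤ 34
  atMost34 σ = ≤-trans (separatedIn≤bestSweep distanceOnePairs σ) (≤-reflexive bestSweep-distanceOnePairs)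

mainTheorem5 : FracSepDimEq Petersen 30 17
mainTheorem5 = fracSepDim-fromBounds 30 17 refl petersen-upperBound petersen-lowerBound
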